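{- Let $(\mathcal{C},\otimes,I)$ be a small symmetric monoidal category. For sequences of objects $\mathbf{X}=(X_0,X_1,\dots)$ and $\mathbf{Y}=(Y_0,Y_1,\dots)$ of $\mathcal{C}$, let $$\mathrm{iSeq}(\mathbf{X},\mathbf{Y}) := \sum_{(M_n)_{n\in\mathbb{N}}} \prod_{n=0}^{\infty}\mathcal{C}(M_{n-1}\otimes X_n,\ M_n\otimes Y_n),$$ where the sum ranges over all sequences $(M_0,M_1,\dots)$ of objects of $\mathcal{C}$ and $M_{ -1}:=I$ (elements are "intensional sequences" $(f_n\colon M_{n-1}\otimes X_n\to M_n\otimes Y_n)_{n}$). Then $\mathrm{iSeq}$ is a fixpoint of the endofunctor $\Psi$ on $[(\mathcal{C}^{\mathbb{N}})^{op}\times\mathcal{C}^{\mathbb{N}},\mathbf{Set}]$ given by $$\Psi(T)(\mathbf{X},\mathbf{Y}) = \sum_{M\in\mathrm{Ob}(\mathcal{C})}\mathcal{C}(X_0,M\otimes Y_0)\times T(M\cdot\mathbf{X}^+,\mathbf{Y}^+),$$ i.e. $\mathrm{iSeq}(\mathbf{X},\mathbf{Y})\cong\sum_{M}\mathcal{C}(X_0,M\otimes Y_0)\times\mathrm{iSeq}(M\cdot\mathbf{X}^+,\mathbf{Y}^+)$ (by splitting off the first component), and it is the final such fixpoint (final $\Psi$-coalgebra). In other words, the set of intensional monoidal streams, defined as the final fixpoint of $\Psi$, is isomorphic to $\mathrm{iSeq}$.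
   Context: $\mathcal{C}^{\mathbb{N}}$ is the category whose objects are sequences $\mathbf{X}=(X_0,X_1,\dots)$ of objects of $\mathcal{C}$ and whose morphisms are sequences of morphisms $(f_n\colon X_n\to Y_n)_n$. For a sequence $\mathbf{X}$, its tail is $\mathbf{X}^+=(X_1,X_2,\dots)$; for an object $M$, $M\cdot\mathbf{X}=(M\otimes X_0,X_1,X_2,\dots)$, so $M\cdot\mathbf{X}^+=(M\otimes X_1,X_2,\dots)$. Associators and unitors are suppressed. -}

module Defs where

open import Level using (0ℓ)
open import Data.Nat using (ℕ; zero; suc)
open import Data.Product using (Σ; Σ-syntax; _,_; _×_; proj₁; proj₂)
open import Relation.Binary using (Rel; IsEquivalence)
open import Relation.Binary.PropositionalEquality using (_≡_; subst)

-- Small symmetric monoidal categories (hom-sets with propositional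
-- equality; objects and morphisms live in Set, so the category is small).

record SymMonCat : Set₁ where
  infixr 9 _∘_
  infixr 10 _⊗₀_ _⊗₁_
  field
    Ob  : Set
    Hom : Ob → Ob → Set
    id  : ∀ {A} → Hom A A
    _∘_ : ∀ {A B C} → Hom B C → Hom A B → Hom A C
    identityˡ : ∀ {A B} {f : Hom A B} → id ∘ f ≡ f
    identityʳ : ∀ {A B} {f : Hom A B} → f ∘ id ≡ f
    assoc : ∀ {A B C D} {f : Hom A B} {g : Hom B C} {h : Hom C D} →
            (h ∘ g) ∘ f ≡ h ∘ (g ∘ f)
    _⊗₀_ : Ob → Ob → Ob
    _⊗₁_ : ∀ {A B C D} → Hom A B → Hom C D → Hom (A ⊗₀ C) (B ⊗₀ D)
    ⊗-id : ∀ {A B} → id {A} ⊗₁ id {B} ≡ id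
    ⊗-∘  : ∀ {A B C D E F} {f : Hom B C} {g : Hom A B} {h : Hom E F} {k : Hom D E} →
           (f ∘ g) ⊗₁ (h ∘ k) ≡ (f ⊗₁ h) ∘ (g ⊗₁ k)
    I : Ob
    unitorˡ⇒ : ∀ {A} → Hom (I ⊗₀ A) A
    unitorˡ⇐ : ∀ {A} → Hom A (I ⊗₀ A)
    unitorˡ-isoˡ : ∀ {A} → unitorˡ⇐ {A} ∘ unitorˡ⇒ ≡ id
    unitorˡ-isoʳ : ∀ {A} → unitorˡ⇒ {A} ∘ unitorˡ⇐ ≡ id
    unitorˡ-nat : ∀ {A B} {f : Hom A B} → f ∘ unitorˡ⇒ ≡ unitorˡ⇒ ∘ (id ⊗₁ f)
    unitorʳ⇒ : ∀ {A} → Hom (A ⊗₀ I) A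
    unitorʳ⇐ : ∀ {A} → Hom A (A ⊗₀ I)
    unitorʳ-isoˡ : ∀ {A} → unitorʳ⇐ {A} ∘ unitorʳ⇒ ≡ id
    unitorʳ-isoʳ : ∀ {A} → unitorʳ⇒ {A} ∘ unitorʳ⇐ ≡ id
    unitorʳ-nat : ∀ {A B} {f : Hom A B} → f ∘ unitorʳ⇒ ≡ unitorʳ⇒ ∘ (f ⊗₁ id)
    assoc⇒ : ∀ {A B C} → Hom ((A ⊗₀ B) ⊗₀ C) (A ⊗₀ (B ⊗₀ C))
    assoc⇐ : ∀ {A B C} → Hom (A ⊗₀ (B ⊗₀ C)) ((A ⊗₀ B) ⊗₀ C)
    assoc-isoˡ : ∀ {A B C} → assoc⇐ {A} {B} {C} ∘ assoc⇒ ≡ id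
    assoc-isoʳ : ∀ {A B C} → assoc⇒ {A} {B} {C} ∘ assoc⇐ ≡ id
    assoc-nat : ∀ {A B C D E F} {f : Hom A D} {g : Hom B E} {h : Hom C F} →
                (f ⊗₁ (g ⊗₁ h)) ∘ assoc⇒ ≡ assoc⇒ ∘ ((f ⊗₁ g) ⊗₁ h)
    triangle : ∀ {A B} → (id {A} ⊗₁ unitorˡ⇒ {B}) ∘ assoc⇒ ≡ unitorʳ⇒ ⊗₁ id {B}
    pentagon : ∀ {A B C D} →
      (id {A} ⊗₁ assoc⇒ {B} {C} {D}) ∘ (assoc⇒ ∘ (assoc⇒ ⊗₁ id))
        ≡ assoc⇒ ∘ assoc⇒
    braiding : ∀ {A B} → Hom (A ⊗₀ B) (B ⊗₀ A)
    braiding-nat : ∀ {A B C D} {f : Hom A C} {g : Hom B D} →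
                   (g ⊗₁ f) ∘ braiding ≡ braiding ∘ (f ⊗₁ g)
    commutative : ∀ {A B} → braiding {B} {A} ∘ braiding {A} {B} ≡ id
    hexagon : ∀ {A B C} →
      assoc⇒ {B} {C} {A} ∘ (braiding {A} {B ⊗₀ C} ∘ assoc⇒ {A} {B} {C})
        ≡ (id ⊗₁ braiding {A} {C}) ∘ (assoc⇒ {B} {A} {C} ∘ (braiding {A} {B} ⊗₁ id))

module Streams (C : SymMonCat) where
  open SymMonCat C

  Seq : Set
  Seq = ℕ → Ob

  SeqHom : Seq → Seq → Set
  SeqHom X Y = (n : ℕ) → Hom (X n) (Y n)

  idS : ∀ {X} → SeqHom X X
  idS n = id

  _∘S_ : ∀ {X Y Z} → SeqHom Y Z → SeqHom X Y → SeqHom X Z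
  (g ∘S f) n = g n ∘ f n

  tail : Seq → Seq
  tail X n = X (suc n)

  tailH : ∀ {X Y} → SeqHom X Y → SeqHom (tail X) (tail Y)
  tailH f n = f (suc n)

  _·_ : Ob → Seq → Seq
  (M · X) zero = M ⊗₀ X zero
  (M · X) (suc n) = X (suc n)

  _·H_ : ∀ {X Y} (M : Ob) → SeqHom X Y → SeqHom (M · X) (M · Y)
  (M ·H f) zero = id {M} ⊗₁ f zero
  (M ·H f) (suc n) = f (suc n)

  -- Profunctors (C^ℕ)^op × C^ℕ → Set, with Set modelled by setoids.

  record PreProf : Set₁ where
    field
      F₀  : Seq → Seq → Set
      _≈_ : ∀ {X Y} → Rel (F₀ X Y) 0ℓ
      F₁  : ∀ {X X' Y Y'} → SeqHom X' X → SeqHom Y Y' → F₀ X Y → F₀ X' Y'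

  record IsProf (P : PreProf) : Set₁ where
    open PreProf P
    field
      isEquivalence : ∀ {X Y} → IsEquivalence (_≈_ {X} {Y})
      F-cong : ∀ {X X' Y Y'} {a : SeqHom X' X} {b : SeqHom Y Y'} {t t' : F₀ X Y} →
               t ≈ t' → F₁ a b t ≈ F₁ a b t'
      F-resp : ∀ {X X' Y Y'} {a a' : SeqHom X' X} {b b' : SeqHom Y Y'} →
               (∀ n → a n ≡ a' n) → (∀ n → b n ≡ b' n) →
               ∀ (t : F₀ X Y) → F₁ a b t ≈ F₁ a' b' t
      F-id : ∀ {X Y} (t : F₀ X Y) → F₁ idS idS t ≈ t
      F-∘ : ∀ {X X' X'' Y Y' Y''} {a : SeqHom X' X} {a' : SeqHom X'' X'}
              {b : SeqHom Y Y'} {b' : SeqHom Y' Y''} (t : F₀ X Y) →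
            F₁ (a ∘S a') (b' ∘S b) t ≈ F₁ a' b' (F₁ a b t)

  record IsNat (P Q : PreProf) (η : ∀ {X Y} → PreProf.F₀ P X Y → PreProf.F₀ Q X Y) : Set₁ where
    private
      module P = PreProf P
      module Q = PreProf Q
    field
      η-cong : ∀ {X Y} {t t' : P.F₀ X Y} → t P.≈ t' → η t Q.≈ η t'
      natural : ∀ {X X' Y Y'} (a : SeqHom X' X) (b : SeqHom Y Y') (t : P.F₀ X Y) →
                η (P.F₁ a b t) Q.≈ Q.F₁ a b (η t)

  module _ (T : PreProf) where
    private module T = PreProf T

    ΨF₀ : Seq → Seq → Set
    ΨF₀ X Y = Σ[ M ∈ Ob ] (Hom (X zero) (M ⊗₀ Y zero) × T.F₀ (M · tail X) (tail Y))

    record ΨEq {X Y : Seq} (p q : ΨF₀ X Y) : Set where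
      field
        obj-eq : proj₁ p ≡ proj₁ q
        hom-eq : subst (λ M → Hom (X zero) (M ⊗₀ Y zero)) obj-eq (proj₁ (proj₂ p))
                 ≡ proj₁ (proj₂ q)
        rest-eq : subst (λ M → T.F₀ (M · tail X) (tail Y)) obj-eq (proj₂ (proj₂ p))
                  T.≈ proj₂ (proj₂ q)

    ΨF₁ : ∀ {X X' Y Y'} → SeqHom X' X → SeqHom Y Y' → ΨF₀ X Y → ΨF₀ X' Y'
    ΨF₁ a b (M , g , t) =
      M , (id {M} ⊗₁ b zero) ∘ (g ∘ a zero) , T.F₁ (M ·H tailH a) (tailH b) t

    Ψ : PreProf
    Ψ = record { F₀ = ΨF₀ ; _≈_ = λ {X} {Y} → ΨEq {X} {Y} ; F₁ = ΨF₁ }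

  Ψ₁ : ∀ {T U : PreProf} → (∀ {X Y} → PreProf.F₀ T X Y → PreProf.F₀ U X Y) →
       ∀ {X Y} → PreProf.F₀ (Ψ T) X Y → PreProf.F₀ (Ψ U) X Y
  Ψ₁ η (M , g , t) = M , g , η t

  -- the domain M_{n-1} ⊗ Xₙ  (with I ⊗ X₀ identified with X₀)
  src : Seq → Seq → Seq
  src M X zero = X zero
  src M X (suc n) = M n ⊗₀ X (suc n)

  iSeqF₀ : Seq → Seq → Set
  iSeqF₀ X Y = Σ[ M ∈ Seq ] ((n : ℕ) → Hom (src M X n) (M n ⊗₀ Y n))

  iSeqEq : ∀ {X Y} → Rel (iSeqF₀ X Y) 0ℓ
  iSeqEq {X} {Y} (M , f) (M' , f') =
    ∀ n → _≡_ {A = Σ[ m ∈ Ob ] Σ[ s ∈ Ob ] Hom s (m ⊗₀ Y n)}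
              (M n , src M X n , f n) (M' n , src M' X n , f' n)

  srcH : ∀ {X X'} (M : Seq) → SeqHom X' X → SeqHom (src M X') (src M X)
  srcH M a zero = a zero
  srcH M a (suc n) = id {M n} ⊗₁ a (suc n)

  iSeqF₁ : ∀ {X X' Y Y'} → SeqHom X' X → SeqHom Y Y' → iSeqF₀ X Y → iSeqF₀ X' Y'
  iSeqF₁ a b (M , f) = M , λ n → (id {M n} ⊗₁ b n) ∘ (f n ∘ srcH M a n)

  iSeq : PreProf
  iSeq = record { F₀ = iSeqF₀ ; _≈_ = iSeqEq ; F₁ = iSeqF₁ }

  split : ∀ {X Y} → iSeqF₀ X Y → PreProf.F₀ (Ψ iSeq) X Y
  split {X} {Y} (M , f) = M zero , f zero , ((λ n → M (suc n)) , rest)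
    where
    rest : (n : ℕ) → Hom (src (λ k → M (suc k)) (M zero · tail X) n) (M (suc n) ⊗₀ Y (suc n))
    rest zero = f (suc zero)
    rest (suc n) = f (suc (suc n))

  IsCoalgHom : (T : PreProf) (β : ∀ {X Y} → PreProf.F₀ T X Y → PreProf.F₀ (Ψ T) X Y)
               (P : PreProf) (c : ∀ {X Y} → PreProf.F₀ P X Y → PreProf.F₀ (Ψ P) X Y)
               (h : ∀ {X Y} → PreProf.F₀ T X Y → PreProf.F₀ P X Y) → Set₁
  IsCoalgHom T β P c h =
    IsNat T P h ×
    (∀ {X Y} (t : PreProf.F₀ T X Y) → PreProf._≈_ (Ψ P) {X} {Y} (c {X} {Y} (h {X} {Y} t)) (Ψ₁ {T} {P} h {X} {Y} (β {X} {Y} t)))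

  IsFinalCoalg : (P : PreProf) (c : ∀ {X Y} → PreProf.F₀ P X Y → PreProf.F₀ (Ψ P) X Y) → Set₁
  IsFinalCoalg P c =
    ∀ (T : PreProf) → IsProf T →
    (β : ∀ {X Y} → PreProf.F₀ T X Y → PreProf.F₀ (Ψ T) X Y) → IsNat T (Ψ T) β →
    Σ[ h ∈ (∀ {X Y} → PreProf.F₀ T X Y → PreProf.F₀ P X Y) ]
      (IsCoalgHom T β P c h ×
       (∀ (h' : ∀ {X Y} → PreProf.F₀ T X Y → PreProf.F₀ P X Y) →
          IsCoalgHom T β P c h' →
          ∀ {X Y} (t : PreProf.F₀ T X Y) → PreProf._≈_ P {X} {Y} (h' {X} {Y} t) (h {X} {Y} t)))

-- An intensional sequence is determined by its components
-- (Mₙ, M_{n-1} ⊗ Xₙ, fₙ), and splitting off the first component only regroups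
-- them, so split is a natural isomorphism with inverse join. Given a
-- Ψ-coalgebra β : T ⇒ Ψ T, iterating β n times on t ∈ T(X,Y) produces an
-- n-th state together with the n-th morphism; the unfolding of t is the
-- sequence of these. Any coalgebra morphism h into iSeq satisfies
-- component (h t) (n+1) = component (h t') n, where t' is the state after one
-- step of β, so by induction on n it agrees with the unfolding.
module Submission where

open import Data.Nat using (ℕ; zero; suc)
open import Data.Product using (Σ-syntax; _×_; _,_; proj₁; proj₂)
open import Data.Unit using (⊤)
open import Relation.Binary.PropositionalEquality
  using (_≡_; refl; sym; trans; cong; cong₂; module ≡-Reasoning)

open import Defs

module IntensionalStreams (C : SymMonCat) where
  open SymMonCat C
  open Streams C
  open ≡-Reasoning

  Component : Ob → Set
  Component B = Σ[ m ∈ Ob ] Σ[ s ∈ Ob ] Hom s (m ⊗₀ B)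

  component : ∀ {X Y} → iSeqF₀ X Y → (n : ℕ) → Component (Y n)
  component {X} (M , f) n = M n , src M X n , f n

  ≈-pointwise : ∀ {X Y} (M : Seq) {f f' : (n : ℕ) → Hom (src M X n) (M n ⊗₀ Y n)} →
                (∀ n → f n ≡ f' n) → iSeqEq {X} {Y} (M , f) (M , f')
  ≈-pointwise {X} M f≡f' n = cong (λ g → M n , src M X n , g) (f≡f' n)

  -- The source of a component may depend on an index k (e.g. the previous
  -- state) that the component itself does not determine.
  component-map : ∀ {K : Set} {B B'} (σ σ' : K → Ob) {k k' : K} {m m' : Ob}
                  {f : Hom (σ k) (m ⊗₀ B)} {f' : Hom (σ k') (m' ⊗₀ B)} →
                  (G : ∀ {k m} → Hom (σ k) (m ⊗₀ B) → Hom (σ' k) (m ⊗₀ B')) →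
                  k ≡ k' → _≡_ {A = Component B} (m , σ k , f) (m' , σ k' , f') →
                  _≡_ {A = Component B'} (m , σ' k , G f) (m' , σ' k' , G f')
  component-map σ σ' G refl refl = refl

  id⊗-homomorphism : ∀ {M A B D} {u : Hom B D} {v : Hom A B} →
                     id {M} ⊗₁ (u ∘ v) ≡ (id ⊗₁ u) ∘ (id ⊗₁ v)
  id⊗-homomorphism = trans (cong (_⊗₁ _) (sym identityˡ)) ⊗-∘

  srcH-cong : ∀ {X X'} (M : Seq) {a a' : SeqHom X' X} →
              (∀ n → a n ≡ a' n) → ∀ n → srcH M a n ≡ srcH M a' n
  srcH-cong M a≡a' zero = a≡a' zero
  srcH-cong M a≡a' (suc n) = cong (id ⊗₁_) (a≡a' (suc n))

  srcH-identity : ∀ {X} (M : Seq) n → srcH {X} M idS n ≡ id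
  srcH-identity M zero = refl
  srcH-identity M (suc n) = ⊗-id

  srcH-homomorphism : ∀ {X X' X''} (M : Seq) (a : SeqHom X' X) (a' : SeqHom X'' X') n →
                      srcH M (a ∘S a') n ≡ srcH M a n ∘ srcH M a' n
  srcH-homomorphism M a a' zero = refl
  srcH-homomorphism M a a' (suc n) = id⊗-homomorphism

  iSeqF₁-cong : ∀ {X X' Y Y'} (a : SeqHom X' X) (b : SeqHom Y Y') {s s' : iSeqF₀ X Y} →
                iSeqEq s s' → iSeqEq (iSeqF₁ a b s) (iSeqF₁ a b s')
  iSeqF₁-cong {X' = X'} a b s≈s' zero =
    component-map {K = ⊤} _ (λ _ → X' zero) (λ {_} {m} g → (id {m} ⊗₁ b zero) ∘ (g ∘ a zero))
      refl (s≈s' zero)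
  iSeqF₁-cong {X} {X'} a b s≈s' (suc n) =
    component-map (_⊗₀ X (suc n)) (_⊗₀ X' (suc n))
      (λ {p} {m} g → (id {m} ⊗₁ b (suc n)) ∘ (g ∘ (id {p} ⊗₁ a (suc n))))
      (cong proj₁ (s≈s' n)) (s≈s' (suc n))

  iSeqF₁-resp : ∀ {X X' Y Y'} {a a' : SeqHom X' X} {b b' : SeqHom Y Y'} →
                (∀ n → a n ≡ a' n) → (∀ n → b n ≡ b' n) →
                (s : iSeqF₀ X Y) → iSeqEq (iSeqF₁ a b s) (iSeqF₁ a' b' s)
  iSeqF₁-resp a≡a' b≡b' (M , f) = ≈-pointwise M λ n →
    cong₂ (λ u v → (id ⊗₁ u) ∘ (f n ∘ v)) (b≡b' n) (srcH-cong M a≡a' n)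

  iSeqF₁-identity : ∀ {X Y} (s : iSeqF₀ X Y) → iSeqEq (iSeqF₁ idS idS s) s
  iSeqF₁-identity (M , f) = ≈-pointwise M λ n → begin
    (id ⊗₁ id) ∘ (f n ∘ srcH M idS n)
      ≡⟨ cong₂ (λ u v → u ∘ (f n ∘ v)) ⊗-id (srcH-identity M n) ⟩
    id ∘ (f n ∘ id)  ≡⟨ identityˡ ⟩
    f n ∘ id         ≡⟨ identityʳ ⟩
    f n              ∎

  iSeqF₁-homomorphism : ∀ {X X' X'' Y Y' Y''} {a : SeqHom X' X} {a' : SeqHom X'' X'}
                          {b : SeqHom Y Y'} {b' : SeqHom Y' Y''} (s : iSeqF₀ X Y) →
                        iSeqEq (iSeqF₁ (a ∘S a') (b' ∘S b) s) (iSeqF₁ a' b' (iSeqF₁ a b s))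
  iSeqF₁-homomorphism {a = a} {a'} {b} {b'} (M , f) = ≈-pointwise M λ n → begin
    (id ⊗₁ (b' n ∘ b n)) ∘ (f n ∘ srcH M (a ∘S a') n)
      ≡⟨ cong₂ (λ u v → u ∘ (f n ∘ v)) id⊗-homomorphism (srcH-homomorphism M a a' n) ⟩
    ((id ⊗₁ b' n) ∘ (id ⊗₁ b n)) ∘ (f n ∘ (srcH M a n ∘ srcH M a' n))
      ≡⟨ assoc ⟩
    (id ⊗₁ b' n) ∘ ((id ⊗₁ b n) ∘ (f n ∘ (srcH M a n ∘ srcH M a' n)))
      ≡⟨ cong ((id ⊗₁ b' n) ∘_) (sym (trans assoc (cong ((id ⊗₁ b n) ∘_) assoc))) ⟩
    (id ⊗₁ b' n) ∘ (((id ⊗₁ b n) ∘ (f n ∘ srcH M a n)) ∘ srcH M a' n)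
      ∎

  iSeq-isProf : IsProf iSeq
  iSeq-isProf = record
    { isEquivalence = record
      { refl = λ n → refl
      ; sym = λ s≈s' n → sym (s≈s' n)
      ; trans = λ s≈s' s'≈s'' n → trans (s≈s' n) (s'≈s'' n)
      }
    ; F-cong = λ {_} {_} {_} {_} {a} {b} → iSeqF₁-cong a b
    ; F-resp = iSeqF₁-resp
    ; F-id = iSeqF₁-identity
    ; F-∘ = iSeqF₁-homomorphism
    }

  -- The carriers of Ψ T and iSeq are Σ-types from which X and Y cannot be
  -- inferred, so they are often passed explicitly below.
  head : ∀ {T X Y} → PreProf.F₀ (Ψ T) X Y → Component (Y zero)
  head {X = X} p = proj₁ p , X zero , proj₁ (proj₂ p)

  next : ∀ {T X Y} (p : PreProf.F₀ (Ψ T) X Y) → PreProf.F₀ T (proj₁ p · tail X) (tail Y)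
  next p = proj₂ (proj₂ p)

  Ψ≈⇒head-≡ : ∀ {T X Y} {p q : PreProf.F₀ (Ψ T) X Y} → ΨEq T {X} {Y} p q →
              head {T} {X} {Y} p ≡ head {T} {X} {Y} q
  Ψ≈⇒head-≡ {p = _ , _ , _} {q = _ , _ , _} record { obj-eq = refl ; hom-eq = refl } = refl

  Ψ≈⇒next-component-≡ :
    ∀ {T} (h : ∀ {X Y} → PreProf.F₀ T X Y → iSeqF₀ X Y) n →
    (∀ {X Y} {u u' : PreProf.F₀ T X Y} → PreProf._≈_ T u u' →
       component (h u) n ≡ component (h u') n) →
    ∀ {X Y} {p q : PreProf.F₀ (Ψ T) X Y} → ΨEq T {X} {Y} p q →
    component (h (next {T} {X} {Y} p)) n ≡ component (h (next {T} {X} {Y} q)) n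
  Ψ≈⇒next-component-≡ h n h-cong {p = _ , _ , _} {q = _ , _ , _}
    record { obj-eq = refl ; rest-eq = u≈u' } = h-cong u≈u'

  ≈-split : ∀ {X Y} {p q : PreProf.F₀ (Ψ iSeq) X Y} →
            head {iSeq} {X} {Y} p ≡ head {iSeq} {X} {Y} q →
            (∀ n → component (next {iSeq} {X} {Y} p) n ≡ component (next {iSeq} {X} {Y} q) n) →
            ΨEq iSeq {X} {Y} p q
  ≈-split {p = _ , _ , _} {q = _ , _ , _} refl next≈ =
    record { obj-eq = refl ; hom-eq = refl ; rest-eq = next≈ }

  component-next-split : ∀ {X Y} (s : iSeqF₀ X Y) n →
                         component (next {iSeq} {X} {Y} (split s)) n ≡ component s (suc n)
  component-next-split s zero = refl
  component-next-split s (suc n) = refl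

  split-cong : ∀ {X Y} {s s' : iSeqF₀ X Y} → iSeqEq s s' → ΨEq iSeq {X} {Y} (split s) (split s')
  split-cong {X} {Y} {s = s} {s'} s≈s' = ≈-split (s≈s' zero) λ n → begin
    component (next {iSeq} {X} {Y} (split s)) n   ≡⟨ component-next-split s n ⟩
    component s (suc n)                           ≡⟨ s≈s' (suc n) ⟩
    component s' (suc n)                          ≡⟨ component-next-split s' n ⟨
    component (next {iSeq} {X} {Y} (split s')) n  ∎

  split-natural : ∀ {X X' Y Y'} (a : SeqHom X' X) (b : SeqHom Y Y') (s : iSeqF₀ X Y) →
                  ΨEq iSeq {X'} {Y'} (split (iSeqF₁ a b s)) (ΨF₁ iSeq a b (split s))
  split-natural {X' = X'} {Y' = Y'} a b s =
    ≈-split {X'} {Y'} {p = split (iSeqF₁ a b s)} {q = ΨF₁ iSeq a b (split s)} refl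
      λ { zero → refl ; (suc n) → refl }

  split-isNat : IsNat iSeq (Ψ iSeq) split
  split-isNat = record { η-cong = split-cong ; natural = split-natural }

  join : ∀ {X Y} → PreProf.F₀ (Ψ iSeq) X Y → iSeqF₀ X Y
  join {X} {Y} (m , g , (M , f)) = M₋ , f₋
    where
    M₋ : Seq
    M₋ zero = m
    M₋ (suc n) = M n

    f₋ : (n : ℕ) → Hom (src M₋ X n) (M₋ n ⊗₀ Y n)
    f₋ zero = g
    f₋ (suc zero) = f zero
    f₋ (suc (suc n)) = f (suc n)

  component-join-suc : ∀ {X Y} (p : PreProf.F₀ (Ψ iSeq) X Y) n →
                       component (join {X} {Y} p) (suc n) ≡ component (next {iSeq} {X} {Y} p) n
  component-join-suc p zero = refl
  component-join-suc p (suc n) = refl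

  join-cong : ∀ {X Y} {p q : PreProf.F₀ (Ψ iSeq) X Y} → ΨEq iSeq {X} {Y} p q →
              iSeqEq (join {X} {Y} p) (join q)
  join-cong p≈q zero = Ψ≈⇒head-≡ p≈q
  join-cong {X} {Y} {p = p} {q} p≈q (suc n) = begin
    component (join {X} {Y} p) (suc n)   ≡⟨ component-join-suc p n ⟩
    component (next {iSeq} {X} {Y} p) n
      ≡⟨ Ψ≈⇒next-component-≡ (λ s → s) n (λ s≈s' → s≈s' n) p≈q ⟩
    component (next {iSeq} {X} {Y} q) n  ≡⟨ component-join-suc q n ⟨
    component (join {X} {Y} q) (suc n)   ∎

  join-natural : ∀ {X X' Y Y'} (a : SeqHom X' X) (b : SeqHom Y Y') (p : PreProf.F₀ (Ψ iSeq) X Y) →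
                 iSeqEq (join {X'} {Y'} (ΨF₁ iSeq a b p)) (iSeqF₁ a b (join {X} {Y} p))
  join-natural a b p zero = refl
  join-natural a b p (suc zero) = refl
  join-natural a b p (suc (suc n)) = refl

  join-isNat : IsNat (Ψ iSeq) iSeq join
  join-isNat = record { η-cong = join-cong ; natural = join-natural }

  join-split : ∀ {X Y} (s : iSeqF₀ X Y) → iSeqEq (join {X} {Y} (split s)) s
  join-split s zero = refl
  join-split s (suc zero) = refl
  join-split s (suc (suc n)) = refl

  split-join : ∀ {X Y} (p : PreProf.F₀ (Ψ iSeq) X Y) → ΨEq iSeq {X} {Y} (split (join {X} {Y} p)) p
  split-join {X} {Y} p =
    ≈-split {X} {Y} {p = split (join {X} {Y} p)} {q = p} refl λ { zero → refl ; (suc n) → refl }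

  module Unfold (T : PreProf) (β : ∀ {X Y} → PreProf.F₀ T X Y → PreProf.F₀ (Ψ T) X Y)
                (β-isNat : IsNat T (Ψ T) β) where
    private
      module T = PreProf T
      module β = IsNat β-isNat

    step : ∀ {X Y} (t : T.F₀ X Y) → T.F₀ (proj₁ (β t) · tail X) (tail Y)
    step {X} {Y} t = next {T} {X} {Y} (β t)

    unfoldObj : ∀ {X Y} → T.F₀ X Y → Seq
    unfoldObj t zero = proj₁ (β t)
    unfoldObj t (suc n) = unfoldObj (step t) n

    unfoldHom : ∀ {X Y} (t : T.F₀ X Y) (n : ℕ) →
                Hom (src (unfoldObj t) X n) (unfoldObj t n ⊗₀ Y n)
    unfoldHom t zero = proj₁ (proj₂ (β t))
    unfoldHom t (suc zero) = unfoldHom (step t) zero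
    unfoldHom t (suc (suc n)) = unfoldHom (step t) (suc n)

    unfold : ∀ {X Y} → T.F₀ X Y → iSeqF₀ X Y
    unfold t = unfoldObj t , unfoldHom t

    component-unfold-suc : ∀ {X Y} (t : T.F₀ X Y) n →
                           component (unfold t) (suc n) ≡ component (unfold (step t)) n
    component-unfold-suc t zero = refl
    component-unfold-suc t (suc n) = refl

    component-F₁-unfold-suc :
      ∀ {X X' Y Y'} (a : SeqHom X' X) (b : SeqHom Y Y') (t : T.F₀ X Y) n →
      component (iSeqF₁ a b (unfold t)) (suc n)
        ≡ component (iSeqF₁ (proj₁ (β t) ·H tailH a) (tailH b) (unfold (step t))) n
    component-F₁-unfold-suc a b t zero = refl
    component-F₁-unfold-suc a b t (suc n) = refl

    unfold-cong : ∀ n {X Y} {t t' : T.F₀ X Y} → t T.≈ t' →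
                  component (unfold t) n ≡ component (unfold t') n
    unfold-cong zero t≈t' = Ψ≈⇒head-≡ (β.η-cong t≈t')
    unfold-cong (suc n) {t = t} {t'} t≈t' = begin
      component (unfold t) (suc n)     ≡⟨ component-unfold-suc t n ⟩
      component (unfold (step t)) n
        ≡⟨ Ψ≈⇒next-component-≡ unfold n (unfold-cong n) (β.η-cong t≈t') ⟩
      component (unfold (step t')) n   ≡⟨ component-unfold-suc t' n ⟨
      component (unfold t') (suc n)    ∎

    unfold-natural : ∀ n {X X' Y Y'} (a : SeqHom X' X) (b : SeqHom Y Y') (t : T.F₀ X Y) →
                     component (unfold (T.F₁ a b t)) n ≡ component (iSeqF₁ a b (unfold t)) n
    unfold-natural zero a b t = Ψ≈⇒head-≡ (β.natural a b t)
    unfold-natural (suc n) a b t = begin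
      component (unfold (T.F₁ a b t)) (suc n)
        ≡⟨ component-unfold-suc (T.F₁ a b t) n ⟩
      component (unfold (step (T.F₁ a b t))) n
        ≡⟨ Ψ≈⇒next-component-≡ unfold n (unfold-cong n) (β.natural a b t) ⟩
      component (unfold (T.F₁ (proj₁ (β t) ·H tailH a) (tailH b) (step t))) n
        ≡⟨ unfold-natural n _ _ (step t) ⟩
      component (iSeqF₁ (proj₁ (β t) ·H tailH a) (tailH b) (unfold (step t))) n
        ≡⟨ component-F₁-unfold-suc a b t n ⟨
      component (iSeqF₁ a b (unfold t)) (suc n)
        ∎

    unfold-isCoalgHom : IsCoalgHom T β iSeq split unfold
    unfold-isCoalgHom =
      record { η-cong = λ t≈t' n → unfold-cong n t≈t'
             ; natural = λ a b t n → unfold-natural n a b t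
             } ,
      λ {X} {Y} t →
        ≈-split {X} {Y} {p = split (unfold t)} {q = Ψ₁ {T} {iSeq} unfold {X} {Y} (β t)} refl λ n →
          trans (component-next-split (unfold t) n) (component-unfold-suc t n)

    unfold-unique : (h : ∀ {X Y} → T.F₀ X Y → iSeqF₀ X Y) → IsCoalgHom T β iSeq split h →
                    ∀ n {X Y} (t : T.F₀ X Y) → component (h t) n ≡ component (unfold t) n
    unfold-unique h (_ , square) zero t = Ψ≈⇒head-≡ (square t)
    unfold-unique h h-coalg@(_ , square) (suc n) {X} {Y} t = begin
      component (h t) (suc n)               ≡⟨ component-next-split (h t) n ⟨
      component (next {iSeq} {X} {Y} (split (h t))) n
        ≡⟨ Ψ≈⇒next-component-≡ (λ s → s) n (λ s≈s' → s≈s' n) (square t) ⟩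
      component (h (step t)) n              ≡⟨ unfold-unique h h-coalg n (step t) ⟩
      component (unfold (step t)) n         ≡⟨ component-unfold-suc t n ⟨
      component (unfold t) (suc n)          ∎

  iSeq-isFinalCoalg : IsFinalCoalg iSeq split
  iSeq-isFinalCoalg T _ β β-isNat =
    unfold , unfold-isCoalgHom , λ h h-coalg t n → unfold-unique h h-coalg n t
    where open Unfold T β β-isNat

theorem3p5 : (C : SymMonCat) → let open Streams C in
    IsProf iSeq ×
    IsNat iSeq (Ψ iSeq) split ×
    (Σ[ join ∈ (∀ {X Y} → PreProf.F₀ (Ψ iSeq) X Y → PreProf.F₀ iSeq X Y) ]
       (IsNat (Ψ iSeq) iSeq join ×
        (∀ {X Y} (s : PreProf.F₀ iSeq X Y) → PreProf._≈_ iSeq {X} {Y} (join {X} {Y} (split {X} {Y} s)) s) ×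
        (∀ {X Y} (p : PreProf.F₀ (Ψ iSeq) X Y) → PreProf._≈_ (Ψ iSeq) {X} {Y} (split {X} {Y} (join {X} {Y} p)) p))) ×
    IsFinalCoalg iSeq split
theorem3p5 C =
  iSeq-isProf , split-isNat , (join , join-isNat , join-split , split-join) , iSeq-isFinalCoalg
  where open IntensionalStreams C
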